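{- Let $d\geq 0$ be an integer and let $X$ be a finite simple graph with maximum degree $\Delta(X)\leq d$. Let $D=d\cdot|V(X)|-\sum_{x\in V(X)}\deg_X(x)$ and let $Y$ be a $D$-regular graph. Then there is a $d$-regular graph $Z$ which is a semidirect product $Z=X\rtimes Y$.
   Context: Graphs are simple and finite. For graphs $Z,Y$, a (weak) morphism $\varphi:Z\to Y$ is a map $V(Z)\to V(Y)$ such that whenever $z,z'$ are adjacent or equal in $Z$, $\varphi(z),\varphi(z')$ are adjacent or equal in $Y$. For an edge $zz'$ of $Z$ set $\varphi(zz')=\{\varphi(z),\varphi(z')\}$; for $y\in V(Y)$, $\varphi^{ -1}(y)$ denotes the subgraph of $Z$ induced by $\{z:\varphi(z)=y\}$, and for an edge $y_1y_2$ of $Y$, $\varphi^{ -1}(y_1y_2)=\{zz'\in E(Z):\varphi(zz')=\{y_1,y_2\}\}$. $Z$ is a semidirect product of $X$ and $Y$, written $Z=X\rtimes Y$, if there is a morphism $\varphi:Z\to Y$ such that $\varphi^{ -1}(y)\cong X$ for every $y\in V(Y)$ and $|\varphi^{ -1}(y_1y_2)|=1$ for every edge $y_1y_2\in E(Y)$. -}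

module Defs where

open import Data.Nat using (ℕ; _+_; _*_; _∸_; _≤_)
open import Data.Bool using (Bool; true; false; if_then_else_)
open import Data.Fin using (Fin)
open import Data.List using (List; map; allFin)
open import Data.Nat.ListAction using (sum)
open import Data.Product using (Σ; ∃; _×_; _,_)
open import Data.Sum using (_⊎_)
open import Relation.Binary.PropositionalEquality using (_≡_; _≢_)
open import Function.Definitions using (Injective)

record Graph : Set where
  field
    n      : ℕ
    adj    : Fin n → Fin n → Bool
    sym    : ∀ u v → adj u v ≡ adj v u
    irrefl : ∀ v → adj v v ≡ false
open Graph public

V : Graph → Set
V G = Fin (n G)

Adj : (G : Graph) → V G → V G → Set
Adj G u v = adj G u v ≡ true

deg : (G : Graph) → V G → ℕ
deg G v = sum (map (λ u → if adj G v u then 1 else 0) (allFin (n G)))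

degSum : Graph → ℕ
degSum G = sum (map (deg G) (allFin (n G)))

MaxDegree≤ : Graph → ℕ → Set
MaxDegree≤ G d = ∀ v → deg G v ≤ d

Regular : ℕ → Graph → Set
Regular d G = ∀ v → deg G v ≡ d

IsMorphism : (Z Y : Graph) → (V Z → V Y) → Set
IsMorphism Z Y φ = ∀ z z' → Adj Z z z' → (φ z ≡ φ z' ⊎ Adj Y (φ z) (φ z'))

-- the induced subgraph φ⁻¹(y) of Z is isomorphic to X:
-- an injective map f from V X onto the fibre over y which preserves and
-- reflects adjacency.
FibreIso : (X Z Y : Graph) → (V Z → V Y) → V Y → Set
FibreIso X Z Y φ y =
  Σ (V X → V Z) λ f →
      Injective _≡_ _≡_ f
    × (∀ x → φ (f x) ≡ y)
    × (∀ z → φ z ≡ y → ∃ λ x → f x ≡ z)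
    × (∀ x x' → adj X x x' ≡ adj Z (f x) (f x'))

-- |φ⁻¹(y₁y₂)| = 1 for an edge y₁y₂ of Y.  Since y₁ ≠ y₂, every edge zz'
-- of Z with φ(zz') = {y₁,y₂} has a unique orientation with φ z = y₁ and
-- φ z' = y₂, so we count such ordered pairs: exactly one exists.
UniqueEdgeOver : (Z Y : Graph) → (V Z → V Y) → V Y → V Y → Set
UniqueEdgeOver Z Y φ y₁ y₂ =
  Σ (V Z × V Z) λ { (z , z') →
      (Adj Z z z' × φ z ≡ y₁ × φ z' ≡ y₂)
    × (∀ w w' → Adj Z w w' → φ w ≡ y₁ → φ w' ≡ y₂ → (w ≡ z × w' ≡ z')) }

IsSemidirect : (Z X Y : Graph) → Set
IsSemidirect Z X Y =
  Σ (V Z → V Y) λ φ →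
      IsMorphism Z Y φ
    × (∀ y → FibreIso X Z Y φ y)
    × (∀ y₁ y₂ → Adj Y y₁ y₂ → UniqueEdgeOver Z Y φ y₁ y₂)

{-# OPTIONS --safe #-}
-- Proof idea: the deficiencies d − deg x of the vertices of X add up to D.  Take one
-- copy of X over each vertex y of Y and attach the D edges of Y at y to vertices of
-- that copy, vertex x receiving exactly d − deg x of them (a greedy distribution, since
-- the totals agree).  Joining the two attachment points of every edge of Y yields
-- X ⋊ Y, in which every vertex (y , x) has degree deg x + (d − deg x) = d.
module Submission where

open import Defs hiding (sym)
open import Data.Bool using (Bool; true; false; if_then_else_; _∧_)
open import Data.Bool.Properties using (∧-comm)
open import Data.Fin using (Fin; zero; suc; combine; quotient; remainder; _↑ˡ_; _↑ʳ_; _≟_)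
open import Data.Fin.Properties using (remQuot-combine; combine-remQuot; combine-injectiveʳ)
open import Data.List using (map; allFin; tabulate)
open import Data.List.Properties using (map-tabulate)
open import Data.Maybe using (Maybe; just; nothing; is-just)
open import Data.Maybe.Properties using (just-injective)
open import Data.Nat using (ℕ; zero; suc; _+_; _*_; _∸_; _≤_; _<_; z<s; pred; >-nonZero)
import Data.Nat as ℕ
open import Data.Nat.ListAction as List using ()
open import Data.Nat.Properties
  using ( +-0-commutativeMonoid; +-identityʳ; +-assoc; *-comm; +-cancelˡ-≡
        ; m+n∸n≡m; m∸n+n≡m; m+[n∸m]≡n; m+n≡0⇒m≡0; m+n≡0⇒n≡0; n≢0⇒n>0; suc-pred)
open import Algebra.Properties.CommutativeMonoid.Sum +-0-commutativeMonoid
  using (sum; sum-syntax; sum-cong-≗; sum-replicate-zero; ∑-distrib-+)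
open import Data.Product using (Σ; ∃; ∃₂; _×_; _,_; proj₁; proj₂)
open import Data.Sum using (inj₁; inj₂)
open import Data.Vec.Functional using (updateAt)
open import Data.Vec.Functional.Properties using (updateAt-updates; updateAt-minimal)
open import Function using (_∘_; id; case_of_)
open import Relation.Binary.PropositionalEquality
  using (_≡_; _≢_; refl; sym; trans; cong; cong₂; subst; module ≡-Reasoning)
open import Relation.Nullary using (yes; no; does; contradiction)
open import Relation.Nullary.Decidable using (dec-true; dec-false)

𝟙 : Bool → ℕ
𝟙 b = if b then 1 else 0

sum-map-allFin : ∀ {n} (f : Fin n → ℕ) → List.sum (map f (allFin n)) ≡ ∑[ i < n ] f i
sum-map-allFin f = trans (cong List.sum (map-tabulate id f)) (sum-tabulate f)
  where
  sum-tabulate : ∀ {n} (f : Fin n → ℕ) → List.sum (tabulate f) ≡ ∑[ i < n ] f i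
  sum-tabulate {zero}  f = refl
  sum-tabulate {suc n} f = cong (f zero +_) (sum-tabulate (f ∘ suc))

deg≡∑ : (G : Graph) (v : V G) → deg G v ≡ ∑[ u < n G ] 𝟙 (adj G v u)
deg≡∑ G v = sum-map-allFin (𝟙 ∘ adj G v)

∑-const : ∀ n c → ∑[ i < n ] c ≡ n * c
∑-const zero    c = refl
∑-const (suc n) c = cong (c +_) (∑-const n c)

∑-δ : ∀ {n} (i : Fin n) c → ∑[ j < n ] (if does (i ≟ j) then c else 0) ≡ c
∑-δ {suc n} zero    c = trans (cong (c +_) (sum-replicate-zero n)) (+-identityʳ c)
∑-δ {suc n} (suc i) c = ∑-δ i c

∑-↑ : ∀ m {n} (f : Fin (m + n) → ℕ) →
      ∑[ i < m + n ] f i ≡ ∑[ i < m ] f (i ↑ˡ n) + ∑[ j < n ] f (m ↑ʳ j)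
∑-↑ zero    f = refl
∑-↑ (suc m) f = trans (cong (f zero +_) (∑-↑ m (f ∘ suc))) (sym (+-assoc (f zero) _ _))

∑-combine : ∀ m {k} (f : Fin (m * k) → ℕ) →
            ∑[ i < m * k ] f i ≡ ∑[ i < m ] ∑[ j < k ] f (combine i j)
∑-combine zero    f = refl
∑-combine (suc m) {k} f =
  trans (∑-↑ k f) (cong (∑[ j < k ] f (j ↑ˡ (m * k)) +_) (∑-combine m (f ∘ (k ↑ʳ_))))

∑-∸ : ∀ {n} d (g : Fin n → ℕ) → (∀ i → g i ≤ d) →
      ∑[ i < n ] (d ∸ g i) ≡ d * n ∸ ∑[ i < n ] g i
∑-∸ {n} d g g≤d = begin
  ∑[ i < n ] (d ∸ g i)                        ≡⟨ m+n∸n≡m _ (sum g) ⟨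
  ∑[ i < n ] (d ∸ g i) + sum g ∸ sum g        ≡⟨ cong (_∸ sum g) (∑-distrib-+ (λ i → d ∸ g i) g) ⟨
  ∑[ i < n ] (d ∸ g i + g i) ∸ sum g          ≡⟨ cong (_∸ sum g) (sum-cong-≗ (λ i → m∸n+n≡m (g≤d i))) ⟩
  ∑[ i < n ] d ∸ sum g                        ≡⟨ cong (_∸ sum g) (trans (∑-const n d) (*-comm n d)) ⟩
  d * n ∸ sum g                               ∎
  where open ≡-Reasoning

∑≡0⇒≡0 : ∀ {k} (c : Fin k → ℕ) → ∑[ x < k ] c x ≡ 0 → ∀ x → c x ≡ 0
∑≡0⇒≡0 c eq zero    = m+n≡0⇒m≡0 (c zero) eq
∑≡0⇒≡0 c eq (suc x) = ∑≡0⇒≡0 (c ∘ suc) (m+n≡0⇒n≡0 (c zero) eq) x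

0<∑⇒∃0< : ∀ {k} (c : Fin k → ℕ) → 0 < ∑[ x < k ] c x → ∃ λ x → 0 < c x
0<∑⇒∃0< {suc k} c pos with c zero ℕ.≟ 0
... | no  c₀≢0 = zero , n≢0⇒n>0 c₀≢0
... | yes c₀≡0 with 0<∑⇒∃0< (c ∘ suc) (subst (λ c₀ → 0 < c₀ + sum (c ∘ suc)) c₀≡0 pos)
...   | x , 0<cx = suc x , 0<cx

_≐_ : ∀ {k} → Maybe (Fin k) → Fin k → Bool
nothing ≐ x = false
just a  ≐ x = does (a ≟ x)

≐-refl : ∀ {k} (x : Fin k) → just x ≐ x ≡ true
≐-refl x = dec-true (x ≟ x) refl

≐⇒≡just : ∀ {k} (m : Maybe (Fin k)) x → m ≐ x ≡ true → m ≡ just x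
≐⇒≡just (just a) x eq with a ≟ x
... | yes refl = refl

≐⇒is-just : ∀ {k} (m : Maybe (Fin k)) x → m ≐ x ≡ true → is-just m ≡ true
≐⇒is-just m x eq = cong is-just (≐⇒≡just m x eq)

∑-≐ : ∀ {k} (m : Maybe (Fin k)) → ∑[ x < k ] 𝟙 (m ≐ x) ≡ 𝟙 (is-just m)
∑-≐ {k} nothing  = sum-replicate-zero k
∑-≐     (just a) = ∑-δ a 1

∑-∧≐ : ∀ {k} b (m : Maybe (Fin k)) → (b ≡ true → is-just m ≡ true) →
        ∑[ x < k ] 𝟙 (b ∧ m ≐ x) ≡ 𝟙 b
∑-∧≐ {k} false m _ = sum-replicate-zero k
∑-∧≐     true  m h = trans (∑-≐ m) (cong 𝟙 (h refl))

record Distribution {m k} (f : Fin m → Bool) (c : Fin k → ℕ) : Set where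
  field
    slot         : Fin m → Maybe (Fin k)
    slot-defined : ∀ u → is-just (slot u) ≡ f u
    slot-count   : ∀ x → ∑[ u < m ] 𝟙 (slot u ≐ x) ≡ c x

Split : ∀ {k} → Bool → (Fin k → ℕ) → Set
Split {k} b c = ∃₂ λ (s : Maybe (Fin k)) (c′ : Fin k → ℕ) →
  is-just s ≡ b × (∀ x → c x ≡ 𝟙 (s ≐ x) + c′ x)

∑-split : ∀ {k} (c c′ : Fin k → ℕ) s → (∀ x → c x ≡ 𝟙 (s ≐ x) + c′ x) →
          ∑[ x < k ] c x ≡ 𝟙 (is-just s) + ∑[ x < k ] c′ x
∑-split {k} c c′ s c≗ = begin
  ∑[ x < k ] c x                               ≡⟨ sum-cong-≗ c≗ ⟩
  ∑[ x < k ] (𝟙 (s ≐ x) + c′ x)                 ≡⟨ ∑-distrib-+ (λ x → 𝟙 (s ≐ x)) c′ ⟩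
  ∑[ x < k ] 𝟙 (s ≐ x) + ∑[ x < k ] c′ x        ≡⟨ cong (_+ sum c′) (∑-≐ s) ⟩
  𝟙 (is-just s) + ∑[ x < k ] c′ x               ∎
  where open ≡-Reasoning

split : ∀ {k} b (c : Fin k → ℕ) {r} → ∑[ x < k ] c x ≡ 𝟙 b + r → Split b c
split false c eq = nothing , c , refl , λ x → refl
split true  c eq with 0<∑⇒∃0< c (subst (0 <_) (sym eq) z<s)
... | x₀ , 0<cx₀ = just x₀ , updateAt c x₀ pred , refl , c≗
  where
  c≗ : ∀ x → c x ≡ 𝟙 (just x₀ ≐ x) + updateAt c x₀ pred x
  c≗ x with x₀ ≟ x
  ... | yes refl = sym (trans (cong suc (updateAt-updates x₀ c)) (suc-pred (c x₀) {{>-nonZero 0<cx₀}}))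
  ... | no  x₀≢x = sym (updateAt-minimal x x₀ c (x₀≢x ∘ sym))

Distribution-∷ : ∀ {m k} {f : Fin (suc m) → Bool} {c c′ : Fin k → ℕ} (s : Maybe (Fin k)) →
                 is-just s ≡ f zero → (∀ x → c x ≡ 𝟙 (s ≐ x) + c′ x) →
                 Distribution (f ∘ suc) c′ → Distribution f c
Distribution-∷ s s-defined c≗ D = record
  { slot         = λ { zero → s ; (suc u) → slot u }
  ; slot-defined = λ { zero → s-defined ; (suc u) → slot-defined u }
  ; slot-count   = λ x → trans (cong (𝟙 (s ≐ x) +_) (slot-count x)) (sym (c≗ x))
  }
  where open Distribution D

distribute : ∀ {m k} (f : Fin m → Bool) (c : Fin k → ℕ) →
             ∑[ u < m ] 𝟙 (f u) ≡ ∑[ x < k ] c x → Distribution f c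
distribute {zero} f c eq = record
  { slot = λ () ; slot-defined = λ () ; slot-count = λ x → sym (∑≡0⇒≡0 c (sym eq) x) }
distribute {suc m} {k} f c eq with split (f zero) c (sym eq)
... | s , c′ , s-defined , c≗ = Distribution-∷ s s-defined c≗ (distribute (f ∘ suc) c′ rest)
  where
  rest : ∑[ u < m ] 𝟙 (f (suc u)) ≡ ∑[ x < k ] c′ x
  rest = +-cancelˡ-≡ (𝟙 (f zero)) _ _ (begin
    𝟙 (f zero) + ∑[ u < m ] 𝟙 (f (suc u))   ≡⟨ eq ⟩
    ∑[ x < k ] c x                         ≡⟨ ∑-split c c′ s c≗ ⟩
    𝟙 (is-just s) + ∑[ x < k ] c′ x         ≡⟨ cong (λ b → 𝟙 b + sum c′) s-defined ⟩
    𝟙 (f zero) + ∑[ x < k ] c′ x            ∎)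
    where open ≡-Reasoning

∧≡true : ∀ a {b} → a ∧ b ≡ true → a ≡ true × b ≡ true
∧≡true true b≡true = refl , b≡true

Adj⇒≢ : (G : Graph) {u v : V G} → Adj G u v → u ≢ v
Adj⇒≢ G {u} uv refl = contradiction (trans (sym uv) (irrefl G u)) λ ()

∑-deficiency : ∀ (X : Graph) d → MaxDegree≤ X d →
               ∑[ x < n X ] (d ∸ deg X x) ≡ d * n X ∸ degSum X
∑-deficiency X d Δ≤d =
  trans (∑-∸ d (deg X) Δ≤d) (cong (d * n X ∸_) (sym (sum-map-allFin (deg X))))

-- port y y′ is the vertex of the copy of X over y at which the edge y y′ of Y is
-- attached; the vertex (y , x) of X ⋊ Y is encoded as combine y x.
module SemidirectProduct (X Y : Graph) (port : V Y → V Y → Maybe (V X))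
                         (port-defined : ∀ y y′ → is-just (port y y′) ≡ adj Y y y′) where

  adj⋊ : V Y → V X → V Y → V X → Bool
  adj⋊ y x y′ x′ = if does (y ≟ y′) then adj X x x′ else (port y y′ ≐ x ∧ port y′ y ≐ x′)

  adj⋊-within : ∀ y x x′ → adj⋊ y x y x′ ≡ adj X x x′
  adj⋊-within y x x′ rewrite dec-true (y ≟ y) refl = refl

  adj⋊-across : ∀ {y x y′ x′} → y ≢ y′ → adj⋊ y x y′ x′ ≡ (port y y′ ≐ x ∧ port y′ y ≐ x′)
  adj⋊-across {y} {y′ = y′} y≢y′ rewrite dec-false (y ≟ y′) y≢y′ = refl

  adj⋊-sym : ∀ y x y′ x′ → adj⋊ y x y′ x′ ≡ adj⋊ y′ x′ y x
  adj⋊-sym y x y′ x′ with y ≟ y′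
  ... | yes refl = trans (Graph.sym X x x′) (sym (adj⋊-within y x′ x))
  ... | no  y≢y′ = trans (∧-comm (port y y′ ≐ x) _) (sym (adj⋊-across (y≢y′ ∘ sym)))

  φ : Fin (n Y * n X) → V Y
  φ = quotient {n Y} (n X)

  ψ : Fin (n Y * n X) → V X
  ψ = remainder {n Y} (n X)

  X⋊Y : Graph
  X⋊Y = record
    { n      = n Y * n X
    ; adj    = λ u v → adj⋊ (φ u) (ψ u) (φ v) (ψ v)
    ; sym    = λ u v → adj⋊-sym (φ u) (ψ u) (φ v) (ψ v)
    ; irrefl = λ u → trans (adj⋊-within (φ u) (ψ u) (ψ u)) (irrefl X (ψ u))
    }

  φ-combine : ∀ (y : V Y) (x : V X) → φ (combine y x) ≡ y
  φ-combine y x = cong proj₁ (remQuot-combine {k = n X} y x)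

  ψ-combine : ∀ (y : V Y) (x : V X) → ψ (combine y x) ≡ x
  ψ-combine y x = cong proj₂ (remQuot-combine {k = n X} y x)

  combine-φ-ψ : ∀ {w y x} → φ w ≡ y → ψ w ≡ x → w ≡ combine y x
  combine-φ-ψ {w} refl refl = sym (combine-remQuot {n Y} (n X) w)

  adj-combineʳ : ∀ w (y′ : V Y) (x′ : V X) → adj X⋊Y w (combine y′ x′) ≡ adj⋊ (φ w) (ψ w) y′ x′
  adj-combineʳ w y′ x′ = cong₂ (adj⋊ (φ w) (ψ w)) (φ-combine y′ x′) (ψ-combine y′ x′)

  adj-combine : ∀ (y : V Y) (x : V X) y′ x′ → adj X⋊Y (combine y x) (combine y′ x′) ≡ adj⋊ y x y′ x′
  adj-combine y x y′ x′ =
    trans (adj-combineʳ (combine y x) y′ x′) (cong₂ (λ y x → adj⋊ y x y′ x′) (φ-combine y x) (ψ-combine y x))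

  port-self : ∀ y → port y y ≡ nothing
  port-self y with port y y | port-defined y y
  ... | nothing | _    = refl
  ... | just _  | defd = contradiction (trans defd (irrefl Y y)) λ ()

  port-defined-sym : ∀ y y′ → is-just (port y y′) ≡ is-just (port y′ y)
  port-defined-sym y y′ =
    trans (port-defined y y′) (trans (Graph.sym Y y y′) (sym (port-defined y′ y)))

  port-adj : ∀ {y y′} → Adj Y y y′ → ∃ λ x → port y y′ ≡ just x
  port-adj {y} {y′} yy′ with port y y′ | port-defined y y′
  ... | just x  | _    = x , refl
  ... | nothing | defd = contradiction (trans defd yy′) λ ()

  edge-over : ∀ {w w′ y y′} → y ≢ y′ → Adj X⋊Y w w′ → φ w ≡ y → φ w′ ≡ y′ →
              port y y′ ≡ just (ψ w) × port y′ y ≡ just (ψ w′)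
  edge-over {w} {w′} y≢y′ ww′ refl refl with ∧≡true _ (trans (sym (adj⋊-across y≢y′)) ww′)
  ... | p , p′ = ≐⇒≡just _ _ p , ≐⇒≡just _ _ p′

  φ-morphism : IsMorphism X⋊Y Y φ
  φ-morphism u v uv = case φ u ≟ φ v of λ where
    (yes φu≡φv) → inj₁ φu≡φv
    (no  φu≢φv) → inj₂ (trans (sym (port-defined (φ u) (φ v)))
                              (cong is-just (proj₁ (edge-over φu≢φv uv refl refl))))

  fibre-iso : ∀ y → FibreIso X X⋊Y Y φ y
  fibre-iso y = combine y
              , (λ {x} {x′} → combine-injectiveʳ y x y x′)
              , φ-combine y
              , (λ w φw≡y → ψ w , sym (combine-φ-ψ φw≡y refl))
              , λ x x′ → sym (trans (adj-combine y x y x′) (adj⋊-within y x x′))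

  unique-edge : ∀ y₁ y₂ → Adj Y y₁ y₂ → UniqueEdgeOver X⋊Y Y φ y₁ y₂
  unique-edge y₁ y₂ y₁y₂ =
    (combine y₁ x₁ , combine y₂ x₂) , (edge , φ-combine y₁ x₁ , φ-combine y₂ x₂) , only
    where
    y₁≢y₂ = Adj⇒≢ Y y₁y₂
    y₂y₁ = trans (Graph.sym Y y₂ y₁) y₁y₂
    x₁ = proj₁ (port-adj y₁y₂)
    x₂ = proj₁ (port-adj y₂y₁)
    p₁ = proj₂ (port-adj y₁y₂)
    p₂ = proj₂ (port-adj y₂y₁)

    edge : Adj X⋊Y (combine y₁ x₁) (combine y₂ x₂)
    edge = begin
      adj X⋊Y (combine y₁ x₁) (combine y₂ x₂)   ≡⟨ adj-combine y₁ x₁ y₂ x₂ ⟩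
      adj⋊ y₁ x₁ y₂ x₂                           ≡⟨ adj⋊-across y₁≢y₂ ⟩
      port y₁ y₂ ≐ x₁ ∧ port y₂ y₁ ≐ x₂          ≡⟨ cong₂ (λ a b → a ≐ x₁ ∧ b ≐ x₂) p₁ p₂ ⟩
      just x₁ ≐ x₁ ∧ just x₂ ≐ x₂                ≡⟨ cong₂ _∧_ (≐-refl x₁) (≐-refl x₂) ⟩
      true                                       ∎
      where open ≡-Reasoning

    only : ∀ w w′ → Adj X⋊Y w w′ → φ w ≡ y₁ → φ w′ ≡ y₂ → w ≡ combine y₁ x₁ × w′ ≡ combine y₂ x₂
    only w w′ ww′ φw≡y₁ φw′≡y₂ =
        combine-φ-ψ φw≡y₁ (just-injective (trans (sym q₁) p₁))
      , combine-φ-ψ φw′≡y₂ (just-injective (trans (sym q₂) p₂))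
      where
      q₁ = proj₁ (edge-over y₁≢y₂ ww′ φw≡y₁ φw′≡y₂)
      q₂ = proj₂ (edge-over y₁≢y₂ ww′ φw≡y₁ φw′≡y₂)

  isSemidirect : IsSemidirect X⋊Y X Y
  isSemidirect = φ , φ-morphism , fibre-iso , unique-edge

  ∑-adj⋊ : ∀ y x y′ → ∑[ x′ < n X ] 𝟙 (adj⋊ y x y′ x′) ≡
                      (if does (y ≟ y′) then deg X x else 0) + 𝟙 (port y y′ ≐ x)
  ∑-adj⋊ y x y′ with y ≟ y′
  ... | yes refl = begin
    ∑[ x′ < n X ] 𝟙 (adj X x x′)   ≡⟨ deg≡∑ X x ⟨
    deg X x                        ≡⟨ +-identityʳ _ ⟨
    deg X x + 𝟙 (nothing ≐ x)      ≡⟨ cong (λ m → deg X x + 𝟙 (m ≐ x)) (port-self y) ⟨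
    deg X x + 𝟙 (port y y ≐ x)     ∎
    where open ≡-Reasoning
  ... | no  y≢y′ = ∑-∧≐ (port y y′ ≐ x) (port y′ y) λ p →
    trans (sym (port-defined-sym y y′)) (≐⇒is-just _ _ p)

  deg-X⋊Y : ∀ w → deg X⋊Y w ≡ deg X (ψ w) + ∑[ y′ < n Y ] 𝟙 (port (φ w) y′ ≐ ψ w)
  deg-X⋊Y w = begin
    deg X⋊Y w
      ≡⟨ deg≡∑ X⋊Y w ⟩
    ∑[ u < n Y * n X ] 𝟙 (adj X⋊Y w u)
      ≡⟨ ∑-combine (n Y) _ ⟩
    ∑[ y′ < n Y ] ∑[ x′ < n X ] 𝟙 (adj X⋊Y w (combine y′ x′))
      ≡⟨ sum-cong-≗ (λ y′ → sum-cong-≗ (cong 𝟙 ∘ adj-combineʳ w y′)) ⟩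
    ∑[ y′ < n Y ] ∑[ x′ < n X ] 𝟙 (adj⋊ y x y′ x′)
      ≡⟨ sum-cong-≗ (∑-adj⋊ y x) ⟩
    ∑[ y′ < n Y ] (δ y′ + ports y′)
      ≡⟨ ∑-distrib-+ δ ports ⟩
    ∑[ y′ < n Y ] δ y′ + ∑[ y′ < n Y ] ports y′
      ≡⟨ cong (_+ sum ports) (∑-δ y (deg X x)) ⟩
    deg X x + ∑[ y′ < n Y ] ports y′
      ∎
    where
    open ≡-Reasoning
    y = φ w
    x = ψ w
    δ ports : V Y → ℕ
    δ y′ = if does (y ≟ y′) then deg X x else 0
    ports y′ = 𝟙 (port y y′ ≐ x)

lemma7 : (d : ℕ) (X : Graph) → MaxDegree≤ X d →
    (Y : Graph) → Regular (d * n X ∸ degSum X) Y →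
    Σ Graph (λ Z → Regular d Z × IsSemidirect Z X Y)
lemma7 d X Δ≤d Y D-regular = X⋊Y , regular , isSemidirect
  where
  deficiency : V X → ℕ
  deficiency x = d ∸ deg X x

  distribution : ∀ y → Distribution (adj Y y) deficiency
  distribution y = distribute (adj Y y) deficiency (begin
    ∑[ y′ < n Y ] 𝟙 (adj Y y y′)   ≡⟨ deg≡∑ Y y ⟨
    deg Y y                        ≡⟨ D-regular y ⟩
    d * n X ∸ degSum X             ≡⟨ ∑-deficiency X d Δ≤d ⟨
    ∑[ x < n X ] deficiency x      ∎)
    where open ≡-Reasoning

  open Distribution
  open SemidirectProduct X Y (slot ∘ distribution) (slot-defined ∘ distribution)

  regular : Regular d X⋊Y
  regular w = begin
    deg X⋊Y w
      ≡⟨ deg-X⋊Y w ⟩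
    deg X (ψ w) + ∑[ y′ < n Y ] 𝟙 (slot (distribution (φ w)) y′ ≐ ψ w)
      ≡⟨ cong (deg X (ψ w) +_) (slot-count (distribution (φ w)) (ψ w)) ⟩
    deg X (ψ w) + (d ∸ deg X (ψ w))
      ≡⟨ m+[n∸m]≡n (Δ≤d (ψ w)) ⟩
    d ∎
    where open ≡-Reasoning
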